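{- Let $G$ be a connected graph with two adjacent vertices of degrees $p$ and $q$, where $p$ and $q$ are prime numbers. If $G$ has neither a vertex of degree $pq$ nor any vertex of degree $1$, then $G$ is prime.
   Context: All graphs are finite, simple and undirected, without isolated vertices. For graphs $H,K$ on the vertex set $V(G)$, $G$ is factored into $H$ and $K$ if $A=BC$, where $A,B,C$ are the adjacency matrices of $G,H,K$ with respect to one common ordering of the vertices. $G$ is prime if in every factorization of $G$ into $H$ and $K$, one of $H$, $K$ is a perfect matching (a $1$-regular spanning graph); a graph with no factorization is prime. -}

module Defs where

open import Data.Nat using (ℕ; zero; suc; _+_; _*_)
open import Data.Bool using (Bool; true; false)
open import Data.Fin using (Fin; zero; suc)
open import Data.Product using (∃-syntax; _×_)
open import Data.Sum using (_⊎_)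
open import Relation.Binary.PropositionalEquality using (_≡_)

∑ : (n : ℕ) → (Fin n → ℕ) → ℕ
∑ zero    f = 0
∑ (suc n) f = f zero + ∑ n (λ i → f (suc i))

bit : Bool → ℕ
bit true  = 1
bit false = 0

record Graph (n : ℕ) : Set where
  field
    adj       : Fin n → Fin n → Bool
    symmetric : ∀ i j → adj i j ≡ adj j i
    loopless  : ∀ i → adj i i ≡ false
    noIsolated : ∀ i → ∃[ j ] (adj i j ≡ true)
open Graph public

A[_] : ∀ {n} → Graph n → Fin n → Fin n → ℕ
A[ G ] i j = bit (adj G i j)

degree : ∀ {n} → Graph n → Fin n → ℕ
degree {n} G i = ∑ n (λ j → A[ G ] i j)

data Reach {n : ℕ} (G : Graph n) : Fin n → Fin n → Set where
  here : ∀ {i} → Reach G i i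
  step : ∀ {i j k} → adj G i j ≡ true → Reach G j k → Reach G i k

Connected : ∀ {n} → Graph n → Set
Connected G = ∀ i j → Reach G i j

-- perfect matching: 1-regular spanning graph
PerfectMatching : ∀ {n} → Graph n → Set
PerfectMatching G = ∀ i → degree G i ≡ 1

-- G is factored into H and K : A = B C (same vertex ordering)
FactoredInto : ∀ {n} → Graph n → Graph n → Graph n → Set
FactoredInto {n} G H K =
  ∀ i j → A[ G ] i j ≡ ∑ n (λ k → A[ H ] i k * A[ K ] k j)

IsPrimeGraph : ∀ {n} → Graph n → Set
IsPrimeGraph {n} G =
  ∀ (H K : Graph n) → FactoredInto G H K → PerfectMatching H ⊎ PerfectMatching K

-- If A = BC for symmetric 0/1 matrices then also A = CB, so A commutes with B
-- and C.  Comparing rows of AC = CA shows that the K-degree is constant along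
-- H-edges (and symmetrically), whence deg_G = deg_H · deg_K.  At the adjacent
-- vertices u, v of prime degree one factor degree is 1.  If it is the same
-- factor at both, connectivity spreads "K-degree 1" over the whole graph, so K
-- is a perfect matching.  Otherwise the middle vertex w of a path u–K–w–H–v (or
-- u–H–w–K–v) inherits H-degree from one end and K-degree from the other, so
-- deg_G w = pq.
module Submission where

open import Defs
open import Data.Nat using (ℕ; zero; suc; _+_; _*_; _≤_; _<_; z≤n; s≤s)
open import Data.Nat.Properties
open import Data.Nat.Divisibility using (divides)
open import Data.Nat.Primality using (Prime; prime⇒irreducible; prime⇒nonZero)
open import Data.Bool using (true; false)
open import Data.Fin using (Fin; zero; suc)
import Data.Fin.Properties as Fin
open import Data.Product using (∃-syntax; _×_; _,_; proj₁)
open import Data.Sum using (_⊎_; inj₁; inj₂)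
open import Data.Empty using (⊥; ⊥-elim)
open import Relation.Nullary using (¬_; yes; no)
open import Relation.Binary.PropositionalEquality
  using (_≡_; _≢_; refl; sym; trans; cong; cong₂; subst; module ≡-Reasoning)
open import Algebra.Properties.Semiring.Sum +-*-semiring
  using (sum; sum-cong-≗; *-distribˡ-sum; *-distribʳ-sum)
  renaming (∑-comm to sum-comm)

∑-cong : ∀ n {f g : Fin n → ℕ} → (∀ i → f i ≡ g i) → ∑ n f ≡ ∑ n g
∑-cong zero    f≗g = refl
∑-cong (suc n) f≗g = cong₂ _+_ (f≗g zero) (∑-cong n (λ i → f≗g (suc i)))

∑-mono : ∀ n {f g : Fin n → ℕ} → (∀ i → f i ≤ g i) → ∑ n f ≤ ∑ n g
∑-mono zero    f≤g = z≤n
∑-mono (suc n) f≤g = +-mono-≤ (f≤g zero) (∑-mono n (λ i → f≤g (suc i)))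

∑≡sum : ∀ n (f : Fin n → ℕ) → ∑ n f ≡ sum f
∑≡sum zero    f = refl
∑≡sum (suc n) f = cong (f zero +_) (∑≡sum n (λ i → f (suc i)))

∑-*ˡ : ∀ n c (f : Fin n → ℕ) → ∑ n (λ i → c * f i) ≡ c * ∑ n f
∑-*ˡ n c f = begin
  ∑ n (λ i → c * f i)  ≡⟨ ∑≡sum n _ ⟩
  sum (λ i → c * f i)  ≡⟨ *-distribˡ-sum c f ⟨
  c * sum f            ≡⟨ cong (c *_) (∑≡sum n f) ⟨
  c * ∑ n f            ∎
  where open ≡-Reasoning

∑-*ʳ : ∀ n c (f : Fin n → ℕ) → ∑ n (λ i → f i * c) ≡ ∑ n f * c
∑-*ʳ n c f = begin
  ∑ n (λ i → f i * c)  ≡⟨ ∑≡sum n _ ⟩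
  sum (λ i → f i * c)  ≡⟨ *-distribʳ-sum c f ⟨
  sum f * c            ≡⟨ cong (_* c) (∑≡sum n f) ⟨
  ∑ n f * c            ∎
  where open ≡-Reasoning

∑-comm : ∀ m n (f : Fin m → Fin n → ℕ) →
         ∑ m (λ i → ∑ n (f i)) ≡ ∑ n (λ j → ∑ m (λ i → f i j))
∑-comm m n f = begin
  ∑ m (λ i → ∑ n (f i))           ≡⟨ ∑≡sum m _ ⟩
  sum (λ i → ∑ n (f i))           ≡⟨ sum-cong-≗ (λ i → ∑≡sum n (f i)) ⟩
  sum (λ i → sum (f i))           ≡⟨ sum-comm f ⟩
  sum (λ j → sum (λ i → f i j))   ≡⟨ sum-cong-≗ (λ j → ∑≡sum m (λ i → f i j)) ⟨
  sum (λ j → ∑ m (λ i → f i j))   ≡⟨ ∑≡sum n _ ⟨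
  ∑ n (λ j → ∑ m (λ i → f i j))   ∎
  where open ≡-Reasoning

term≤∑ : ∀ n (f : Fin n → ℕ) i → f i ≤ ∑ n f
term≤∑ (suc n) f zero    = m≤m+n (f zero) _
term≤∑ (suc n) f (suc i) = ≤-trans (term≤∑ n (λ i → f (suc i)) i) (m≤n+m _ (f zero))

twoTerms≤∑ : ∀ n (f : Fin n → ℕ) {i j} → i ≢ j → f i + f j ≤ ∑ n f
twoTerms≤∑ (suc n) f {zero}  {zero}  i≢j = ⊥-elim (i≢j refl)
twoTerms≤∑ (suc n) f {zero}  {suc j} i≢j = +-monoʳ-≤ (f zero) (term≤∑ n (λ i → f (suc i)) j)
twoTerms≤∑ (suc n) f {suc i} {zero}  i≢j =
  subst (_≤ ∑ (suc n) f) (+-comm (f zero) (f (suc i)))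
        (+-monoʳ-≤ (f zero) (term≤∑ n (λ i → f (suc i)) i))
twoTerms≤∑ (suc n) f {suc i} {suc j} i≢j =
  ≤-trans (twoTerms≤∑ n (λ i → f (suc i)) (λ i≡j → i≢j (cong suc i≡j))) (m≤n+m _ (f zero))

∑-positive⇒∃term : ∀ n (f : Fin n → ℕ) → 0 < ∑ n f → ∃[ i ] 0 < f i
∑-positive⇒∃term (suc n) f ∑f>0 with f zero in f₀≡
... | suc _ = zero , subst (0 <_) (sym f₀≡) (s≤s z≤n)
... | zero with ∑-positive⇒∃term n (λ i → f (suc i)) ∑f>0
...   | i , fᵢ>0 = suc i , fᵢ>0

bit≤1 : ∀ x → bit x ≤ 1
bit≤1 true  = s≤s z≤n
bit≤1 false = z≤n

bit-positive : ∀ {x} → 0 < bit x → x ≡ true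
bit-positive {true} _ = refl

bit*bit-positive : ∀ x y → 0 < bit x * bit y → x ≡ true × y ≡ true
bit*bit-positive true true _ = refl , refl

*bit≤ : ∀ m x → m * bit x ≤ m
*bit≤ m x = ≤-trans (*-monoʳ-≤ m (bit≤1 x)) (≤-reflexive (*-identityʳ m))

Matrix : ℕ → Set
Matrix n = Fin n → Fin n → ℕ

infixl 7 _⊗_
infix 4 _≐_

_⊗_ : ∀ {n} → Matrix n → Matrix n → Matrix n
_⊗_ {n} M N i j = ∑ n (λ k → M i k * N k j)

_≐_ : ∀ {n} → Matrix n → Matrix n → Set
M ≐ N = ∀ i j → M i j ≡ N i j

SymmetricMatrix : ∀ {n} → Matrix n → Set
SymmetricMatrix M = ∀ i j → M i j ≡ M j i

module _ {n : ℕ} where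

  ⊗-congˡ : {L L′ M : Matrix n} → L ≐ L′ → L ⊗ M ≐ L′ ⊗ M
  ⊗-congˡ {M = M} L≐L′ i j = ∑-cong n (λ k → cong (_* M k j) (L≐L′ i k))

  ⊗-congʳ : {L M M′ : Matrix n} → M ≐ M′ → L ⊗ M ≐ L ⊗ M′
  ⊗-congʳ {L = L} M≐M′ i j = ∑-cong n (λ k → cong (L i k *_) (M≐M′ k j))

  ⊗-assoc : (L M N : Matrix n) → (L ⊗ M) ⊗ N ≐ L ⊗ (M ⊗ N)
  ⊗-assoc L M N i j = begin
    ∑ n (λ l → ∑ n (λ k → L i k * M k l) * N l j)    ≡⟨ ∑-cong n (λ l → ∑-*ʳ n (N l j) _) ⟨
    ∑ n (λ l → ∑ n (λ k → L i k * M k l * N l j))    ≡⟨ ∑-comm n n _ ⟩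
    ∑ n (λ k → ∑ n (λ l → L i k * M k l * N l j))    ≡⟨ ∑-cong n (λ k → ∑-cong n (λ l → *-assoc (L i k) _ _)) ⟩
    ∑ n (λ k → ∑ n (λ l → L i k * (M k l * N l j)))  ≡⟨ ∑-cong n (λ k → ∑-*ˡ n (L i k) _) ⟩
    ∑ n (λ k → L i k * ∑ n (λ l → M k l * N l j))    ∎
    where open ≡-Reasoning

  ⊗-transpose : {M N : Matrix n} → SymmetricMatrix M → SymmetricMatrix N →
                ∀ i j → (M ⊗ N) i j ≡ (N ⊗ M) j i
  ⊗-transpose {M} {N} M-sym N-sym i j =
    ∑-cong n (λ k → trans (*-comm (M i k) (N k j)) (cong₂ _*_ (N-sym k j) (M-sym i k)))

  ∑-row-⊗ : (M N : Matrix n) (i : Fin n) → ∑ n ((M ⊗ N) i) ≡ ∑ n (λ k → M i k * ∑ n (N k))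
  ∑-row-⊗ M N i = trans (∑-comm n n _) (∑-cong n (λ k → ∑-*ˡ n (M i k) (N k)))

A[]-symmetric : ∀ {n} (G : Graph n) → SymmetricMatrix A[ G ]
A[]-symmetric G i j = cong bit (symmetric G i j)

degree≡1⇒uniqueNeighbour : ∀ {n} (G : Graph n) {i x y} →
  degree G i ≡ 1 → adj G i x ≡ true → adj G i y ≡ true → x ≡ y
degree≡1⇒uniqueNeighbour {n} G {i} {x} {y} dᵢ≡1 eix eiy with x Fin.≟ y
... | yes x≡y = x≡y
... | no x≢y  = ⊥-elim (1+n≰n (begin
  2                                 ≡⟨ cong₂ (λ s t → bit s + bit t) eix eiy ⟨
  A[ G ] i x + A[ G ] i y           ≤⟨ twoTerms≤∑ n (A[ G ] i) x≢y ⟩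
  degree G i                        ≡⟨ dᵢ≡1 ⟩
  1                                 ∎))
  where open ≤-Reasoning

Reach-preserves : ∀ {n} {G : Graph n} (P : Fin n → Set) →
  (∀ {i j} → adj G i j ≡ true → P i → P j) → ∀ {i j} → Reach G i j → P i → P j
Reach-preserves P step-P here          Pᵢ = Pᵢ
Reach-preserves P step-P (step e path) Pᵢ = Reach-preserves P step-P path (step-P e Pᵢ)

module _ {n : ℕ} (G H K : Graph n) where

  factoredInto-swap : FactoredInto G H K → FactoredInto G K H
  factoredInto-swap fact i j = begin
    A[ G ] i j             ≡⟨ A[]-symmetric G i j ⟩
    A[ G ] j i             ≡⟨ fact j i ⟩
    (A[ H ] ⊗ A[ K ]) j i  ≡⟨ ⊗-transpose (A[]-symmetric H) (A[]-symmetric K) j i ⟩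
    (A[ K ] ⊗ A[ H ]) i j  ∎
    where open ≡-Reasoning

  adjG⇒∃path : FactoredInto G H K → ∀ {i j} → adj G i j ≡ true →
    ∃[ k ] (adj H i k ≡ true × adj K k j ≡ true)
  adjG⇒∃path fact {i} {j} eij with ∑-positive⇒∃term n (λ k → A[ H ] i k * A[ K ] k j)
                                     (subst (0 <_) (fact i j) (≤-reflexive (sym (cong bit eij))))
  ... | k , positive = k , bit*bit-positive (adj H i k) (adj K k j) positive

  path⇒adjG : FactoredInto G H K → ∀ {i k j} → adj H i k ≡ true → adj K k j ≡ true → adj G i j ≡ true
  path⇒adjG fact {i} {k} {j} eik ekj = bit-positive (begin
    1                        ≡⟨ cong₂ (λ s t → bit s * bit t) eik ekj ⟨
    A[ H ] i k * A[ K ] k j  ≤⟨ term≤∑ n (λ k → A[ H ] i k * A[ K ] k j) k ⟩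
    (A[ H ] ⊗ A[ K ]) i j    ≡⟨ fact i j ⟨
    A[ G ] i j               ∎)
    where open ≤-Reasoning

module _ {n : ℕ} (G H K : Graph n) (fact : FactoredInto G H K) where

  private
    swapped : FactoredInto G K H
    swapped = factoredInto-swap G H K fact

  factors-commute : A[ G ] ⊗ A[ K ] ≐ A[ K ] ⊗ A[ G ]
  factors-commute i j = begin
    (A[ G ] ⊗ A[ K ]) i j             ≡⟨ ⊗-congˡ {M = A[ K ]} swapped i j ⟩
    (A[ K ] ⊗ A[ H ] ⊗ A[ K ]) i j    ≡⟨ ⊗-assoc A[ K ] A[ H ] A[ K ] i j ⟩
    (A[ K ] ⊗ (A[ H ] ⊗ A[ K ])) i j  ≡⟨ ⊗-congʳ {L = A[ K ]} fact i j ⟨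
    (A[ K ] ⊗ A[ G ]) i j             ∎
    where open ≡-Reasoning

  -- Every K-neighbour j of k is a G-neighbour of i, so row k of K is
  -- dominated by the row (AC)_i, which equals (CA)_i and is at most deg_K i.
  adjH⇒degreeK≤ : ∀ {i k} → adj H i k ≡ true → degree K k ≤ degree K i
  adjH⇒degreeK≤ {i} {k} eik = begin
    ∑ n (A[ K ] k)                      ≤⟨ ∑-mono n K-row≤ ⟩
    (A[ G ] ⊗ A[ K ]) i k               ≡⟨ factors-commute i k ⟩
    (A[ K ] ⊗ A[ G ]) i k               ≤⟨ ∑-mono n (λ l → *bit≤ (A[ K ] i l) (adj G l k)) ⟩
    ∑ n (A[ K ] i)                      ∎
    where
    open ≤-Reasoning
    K-row≤ : ∀ j → A[ K ] k j ≤ A[ G ] i j * A[ K ] j k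
    K-row≤ j with adj K k j in ekj
    ... | false = z≤n
    ... | true  = ≤-reflexive (sym (cong₂ (λ s t → bit s * bit t)
                    (path⇒adjG G H K fact eik ekj) (trans (symmetric K j k) ekj)))

  adjH⇒degreeK≡ : ∀ {i k} → adj H i k ≡ true → degree K i ≡ degree K k
  adjH⇒degreeK≡ {i} {k} eik =
    ≤-antisym (adjH⇒degreeK≤ (trans (symmetric H k i) eik)) (adjH⇒degreeK≤ eik)

  degree-factorises : ∀ i → degree G i ≡ degree H i * degree K i
  degree-factorises i = begin
    ∑ n (A[ G ] i)                          ≡⟨ ∑-cong n (fact i) ⟩
    ∑ n ((A[ H ] ⊗ A[ K ]) i)               ≡⟨ ∑-row-⊗ A[ H ] A[ K ] i ⟩
    ∑ n (λ k → A[ H ] i k * degree K k)     ≡⟨ ∑-cong n degreeK-along-H ⟩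
    ∑ n (λ k → A[ H ] i k * degree K i)     ≡⟨ ∑-*ʳ n (degree K i) (A[ H ] i) ⟩
    degree H i * degree K i                 ∎
    where
    open ≡-Reasoning
    degreeK-along-H : ∀ k → A[ H ] i k * degree K k ≡ A[ H ] i k * degree K i
    degreeK-along-H k with adj H i k in eik
    ... | false = refl
    ... | true  = cong (1 *_) (sym (adjH⇒degreeK≡ eik))

  -- The K-component of w is a single edge; this is what spreads along G.
  KMatched : Fin n → Set
  KMatched w = degree K w ≡ 1 × (∀ x → adj K w x ≡ true → degree K x ≡ 1)

  adjG⇒KMatched : ∀ {i j} → adj G i j ≡ true →
    degree K i ≡ 1 → degree K j ≡ 1 → KMatched i
  adjG⇒KMatched {i} {j} eij dᵢ≡1 dⱼ≡1 = dᵢ≡1 , partner-matched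
    where
    partner-matched : ∀ x → adj K i x ≡ true → degree K x ≡ 1
    partner-matched x eix with adjG⇒∃path G K H swapped eij
    ... | k , eik , ekj = begin
      degree K x  ≡⟨ cong (degree K) (degree≡1⇒uniqueNeighbour K dᵢ≡1 eix eik) ⟩
      degree K k  ≡⟨ adjH⇒degreeK≡ ekj ⟩
      degree K j  ≡⟨ dⱼ≡1 ⟩
      1           ∎
      where open ≡-Reasoning

  KMatched-step : ∀ {i j} → adj G i j ≡ true → KMatched i → KMatched j
  KMatched-step {i} {j} eij (dᵢ≡1 , partners≡1) with adjG⇒∃path G K H swapped eij
  ... | k , eik , ekj = adjG⇒KMatched (trans (symmetric G j i) eij) dⱼ≡1 dᵢ≡1
    where
    dⱼ≡1 : degree K j ≡ 1
    dⱼ≡1 = trans (sym (adjH⇒degreeK≡ ekj)) (partners≡1 k eik)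

  K-perfectMatching : Connected G → ∀ {u v} → adj G u v ≡ true →
    degree K u ≡ 1 → degree K v ≡ 1 → PerfectMatching K
  K-perfectMatching connected {u} euv dᵤ≡1 dᵥ≡1 w =
    proj₁ (Reach-preserves KMatched KMatched-step (connected u w)
                           (adjG⇒KMatched euv dᵤ≡1 dᵥ≡1))

adjG⇒∃degree≡ : ∀ {n} (G H K : Graph n) → FactoredInto G H K → ∀ {i j} →
  adj G i j ≡ true → ∃[ k ] degree G k ≡ degree H j * degree K i
adjG⇒∃degree≡ G H K fact {i} {j} eij with adjG⇒∃path G H K fact eij
... | k , eik , ekj = k , (begin
  degree G k               ≡⟨ degree-factorises G H K fact k ⟩
  degree H k * degree K k  ≡⟨ cong₂ _*_ (adjH⇒degreeK≡ G K H (factoredInto-swap G H K fact) ekj)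
                                        (sym (adjH⇒degreeK≡ G H K fact eik)) ⟩
  degree H j * degree K i  ∎)
  where open ≡-Reasoning

prime-factors : ∀ {p} x y → Prime p → x * y ≡ p → (x ≡ 1 × y ≡ p) ⊎ (x ≡ p × y ≡ 1)
prime-factors x y p-prime xy≡p
  with prime⇒irreducible p-prime (divides y (trans (sym xy≡p) (*-comm x y)))
... | inj₁ refl = inj₁ (refl , trans (sym (*-identityˡ y)) xy≡p)
... | inj₂ refl = inj₂ (refl , *-cancelˡ-≡ y 1 x {{prime⇒nonZero p-prime}}
                                 (trans xy≡p (sym (*-identityʳ x))))

mainTheorem13 : ∀ {n : ℕ} (G : Graph n) (p q : ℕ) (u v : Fin n) →
    Prime p → Prime q →
    Connected G →
    adj G u v ≡ true → degree G u ≡ p → degree G v ≡ q →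
    (∀ w → ¬ (degree G w ≡ p * q)) →
    (∀ w → ¬ (degree G w ≡ 1)) →
    IsPrimeGraph G
mainTheorem13 G p q u v p-prime q-prime connected euv dᵤ≡p dᵥ≡q no-pq _ H K fact =
  cases (split u p-prime dᵤ≡p) (split v q-prime dᵥ≡q)
  where
  split : ∀ w {r} → Prime r → degree G w ≡ r →
    (degree H w ≡ 1 × degree K w ≡ r) ⊎ (degree H w ≡ r × degree K w ≡ 1)
  split w r-prime d≡r = prime-factors _ _ r-prime (trans (sym (degree-factorises G H K fact w)) d≡r)

  no-qp : ∀ {x y} → ∃[ k ] degree G k ≡ x * y → x ≡ q → y ≡ p → ⊥
  no-qp (k , dₖ≡qp) refl refl = no-pq k (trans dₖ≡qp (*-comm q p))

  cases : (degree H u ≡ 1 × degree K u ≡ p) ⊎ (degree H u ≡ p × degree K u ≡ 1) →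
          (degree H v ≡ 1 × degree K v ≡ q) ⊎ (degree H v ≡ q × degree K v ≡ 1) →
          PerfectMatching H ⊎ PerfectMatching K
  cases (inj₁ (Hu≡1 , _)) (inj₁ (Hv≡1 , _)) =
    inj₁ (K-perfectMatching G K H (factoredInto-swap G H K fact) connected euv Hu≡1 Hv≡1)
  cases (inj₂ (_ , Ku≡1)) (inj₂ (_ , Kv≡1)) =
    inj₂ (K-perfectMatching G H K fact connected euv Ku≡1 Kv≡1)
  cases (inj₁ (_ , Ku≡p)) (inj₂ (Hv≡q , _)) =
    ⊥-elim (no-qp (adjG⇒∃degree≡ G H K fact euv) Hv≡q Ku≡p)
  cases (inj₂ (Hu≡p , _)) (inj₁ (_ , Kv≡q)) =
    ⊥-elim (no-qp (adjG⇒∃degree≡ G K H (factoredInto-swap G H K fact) euv) Kv≡q Hu≡p)
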